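{- For $n\ge4$ and every permutation $\sigma$ of $\{1,\dots,n\}$, the Tseitin graph of $\mathsf{rPar}(n,\sigma)$ is (isomorphic to) the graph obtained by contracting four edges of $G_\sigma$.
   Context: $\mathsf{xor}(y_1,\dots,y_k)$ is the CNF of all $2^{k-1}$ clauses on exactly the literals $y_1,\dots,y_k$ with an odd (if $k$ odd) or even (if $k$ even) number of unnegated $y_j$'s. For a list of $m\ge4$ literals $(y_1,\dots,y_m)$ with fresh variables $t_1,\dots,t_{m-3}$, the linear encoding is $\mathsf{xor}(y_1,y_2,t_1)\wedge\bigwedge_{j=1}^{m-4}\mathsf{xor}(t_j,y_{j+2},t_{j+1})\wedge\mathsf{xor}(t_{m-3},y_{m-1},y_m)$; $\mathsf{Parity}(X,T,\sigma)$ denotes this encoding of $(x_{\sigma(1)},\dots,x_{\sigma(n)})$ with Tseitin variables $T$. With $X=\{x_1,\dots,x_n\}$, $X'=\{x_1,\dots,x_{n-1},\bar x_n\}$ and disjoint fresh sets $S,T$, $\mathsf{rPar}(n,\sigma)=\mathsf{Parity}(X,S,\mathrm{id})\wedge\mathsf{Parity}(X',T,\sigma)$. This formula is a conjunction of $\mathsf{xor}$-blocks in which every variable occurs in exactly two blocks; its Tseitin graph has one vertex per $\mathsf{xor}$-block and, for each variable, an edge joining the two blocks containing it. $G_\sigma$ is the graph on vertices $1,\dots,n,1',\dots,n'$ with edges $\{(i,i+1): i<n\}\cup\{(\sigma(i)',\sigma(i+1)'): i<n\}\cup\{(i,i'): i\le n\}$. -}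

module Defs where

open import Data.Nat using (ℕ; zero; suc; _∸_; _≡ᵇ_)
open import Data.Bool using (Bool; true; false; not; if_then_else_; _∧_; _∨_)
open import Data.Fin using (Fin; toℕ; _↑ˡ_; _↑ʳ_; punchOut; _≟_)
open import Data.Fin.Subset using (Subset)
open import Data.Fin.Permutation using (Permutation′; _⟨$⟩ʳ_)
open import Data.List using (List; []; _∷_; _++_; map; length; allFin; concatMap; foldr)
open import Data.Bool.ListAction using (any)
import Data.Vec as Vec
open Vec using (Vec; []; _∷_)
open import Data.Maybe using (Maybe; just; nothing)
open import Data.Product using (Σ; _×_; _,_; proj₁; proj₂)
open import Data.Sum using (_⊎_)
open import Function using (id; _∘_)
open import Function.Bundles using (_↔_; Inverse)
open import Relation.Binary.PropositionalEquality using (_≡_; _≢_; sym)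
open import Relation.Nullary using (yes; no)

-- xv i = x_{i+1},  sv j = s_{j+1},  tv j = t_{j+1}
data Var : Set where
  xv sv tv : ℕ → Var

_==_ : Var → Var → Bool
xv a == xv b = a ≡ᵇ b
sv a == sv b = a ≡ᵇ b
tv a == tv b = a ≡ᵇ b
_ == _ = false

-- a literal: (polarity, variable); polarity true = unnegated
Lit : Set
Lit = Bool × Var

pos : Var → Lit
pos v = true , v

Block : Set
Block = List Lit

-- its CNF: all 2^(k-1) clauses on exactly y_1..y_k whose number of
-- unnegated literals has the parity of k (a clause = list of literals)
Clause : Set
Clause = List Lit

allSigns : List Lit → List Clause
allSigns [] = [] ∷ []
allSigns ((_ , v) ∷ ys) =
  concatMap (λ c → ((true , v) ∷ c) ∷ ((false , v) ∷ c) ∷ []) (allSigns ys)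

countPos : Clause → ℕ
countPos = foldr (λ l k → if proj₁ l then suc k else k) 0

even : ℕ → Bool
even zero = true
even (suc k) = not (even k)

xorCNF : Block → List Clause
xorCNF ys = Data.List.filterᵇ (λ c → even (countPos c) Data.Bool.xor not (even (length ys))) (allSigns ys)
  where import Data.List; import Data.Bool

Formula : Set
Formula = List Block

CNF : Formula → List Clause
CNF = concatMap xorCNF

-- Linear encoding with fresh variables fresh 0, fresh 1, ...
--   xor(y1,y2,t1) ∧ ⋀_j xor(t_j, y_{j+2}, t_{j+1}) ∧ xor(t_{m-3}, y_{m-1}, y_m)

linChain : (ℕ → Var) → ℕ → List Lit → Formula
linChain fr j (a ∷ b ∷ []) = (pos (fr j) ∷ a ∷ b ∷ []) ∷ []
linChain fr j (a ∷ rest@(_ ∷ _ ∷ _)) =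
  (pos (fr j) ∷ a ∷ pos (fr (suc j)) ∷ []) ∷ linChain fr (suc j) rest
linChain fr j _ = []   -- not reached for m ≥ 4

linEnc : (ℕ → Var) → List Lit → Formula
linEnc fr (y₁ ∷ y₂ ∷ rest) = (y₁ ∷ y₂ ∷ pos (fr 0) ∷ []) ∷ linChain fr 0 rest
linEnc fr _ = []        -- not reached for m ≥ 4

-- X = (x_1..x_n);  X' = (x_1,..,x_{n-1}, ¬x_n)
litX : {n : ℕ} → Fin n → Lit
litX i = true , xv (toℕ i)

litX' : {n : ℕ} → Fin n → Lit
litX' {n} i = not (suc (toℕ i) ≡ᵇ n) , xv (toℕ i)

-- rPar(n,σ) = Parity(X,S,id) ∧ Parity(X',T,σ)
rPar : (n : ℕ) → Permutation′ n → Formula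
rPar n σ = linEnc sv (map litX (allFin n))
        ++ linEnc tv (map (λ i → litX' (σ ⟨$⟩ʳ i)) (allFin n))

-- Finite multigraphs: vertices Fin N, a list of edges (unordered pairs,
-- stored as ordered pairs; loops and parallel edges allowed)

record Graph : Set where
  constructor graph
  field
    N     : ℕ
    edges : List (Fin N × Fin N)
open Graph public

mapPair : {A B : Set} → (A → B) → A × A → B × B
mapPair f (a , b) = f a , f b

SameEdge : {V : Set} → V × V → V × V → Set
SameEdge (a , b) (c , d) = (a ≡ c × b ≡ d) ⊎ (a ≡ d × b ≡ c)

_≅_ : Graph → Graph → Set
G ≅ H = Σ (Fin (N G) ↔ Fin (N H)) λ f →
        Σ (Fin (length (edges G)) ↔ Fin (length (edges H))) λ g →
        ∀ i → SameEdge (Data.List.lookup (edges H) (Inverse.to g i))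
                       (mapPair (Inverse.to f) (Data.List.lookup (edges G) i))
  where import Data.List

-- Tseitin graph of a conjunction of xor-blocks: one vertex per block,
-- one edge per variable joining the two blocks containing it.
-- Defined (just _) only when every variable occurs in exactly two blocks.

varsOf : Formula → List Var
varsOf φ = dedup (concatMap (map proj₂) φ)
  where
  dedup : List Var → List Var
  dedup [] = []
  dedup (v ∷ vs) = v ∷ Data.List.filterᵇ (λ w → not (v == w)) (dedup vs)
    where import Data.List

occursIn : Var → Block → Bool
occursIn v b = any (λ l → proj₂ l == v) b

blocksContaining : (φ : Formula) → Var → List (Fin (length φ))
blocksContaining φ v =
  Data.List.filterᵇ (λ i → occursIn v (Data.List.lookup φ i)) (allFin (length φ))
  where import Data.List

exactlyTwo : {A : Set} → List A → Maybe (A × A)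
exactlyTwo (a ∷ b ∷ []) = just (a , b)
exactlyTwo _ = nothing

allJust : {A : Set} → List (Maybe A) → Maybe (List A)
allJust [] = just []
allJust (nothing ∷ _) = nothing
allJust (just a ∷ ms) with allJust ms
... | just as = just (a ∷ as)
... | nothing = nothing

tseitinGraph : Formula → Maybe Graph
tseitinGraph φ with allJust (map (λ v → exactlyTwo (blocksContaining φ v)) (varsOf φ))
... | just es = just (graph (length φ) es)
... | nothing = nothing

-- G_σ: vertex i (0-indexed) ↦ i ↑ˡ n,  vertex i' ↦ n ↑ʳ i

consecutive : {A : Set} → List A → List (A × A)
consecutive (a ∷ b ∷ rest) = (a , b) ∷ consecutive (b ∷ rest)
consecutive _ = []

Gσ : (n : ℕ) → Permutation′ n → Graph
Gσ n σ = graph (n Data.Nat.+ n)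
  (consecutive (map (_↑ˡ n) (allFin n))
   ++ consecutive (map (λ i → n ↑ʳ (σ ⟨$⟩ʳ i)) (allFin n))
   ++ map (λ i → i ↑ˡ n , n ↑ʳ i) (allFin n))
  where import Data.Nat

-- identify v with u (u ≢ v) and renumber
merge : {N : ℕ} {u v : Fin (suc N)} → u ≢ v → Fin (suc N) → Fin N
merge {u = u} {v} u≢v w with w ≟ v
... | yes _   = punchOut {i = v} {j = u} (λ e → u≢v (sym e))
... | no w≢v  = punchOut {i = v} {j = w} (λ e → w≢v (sym e))

-- the vertex quotient obtained by contracting the given edges one by one
-- (an edge that has already become a loop is simply deleted)
quot : (N : ℕ) {k : ℕ} → Vec (Fin N × Fin N) k → Σ ℕ (λ N' → Fin N → Fin N')
quot N [] = N , id
quot zero ((() , _) ∷ _)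
quot (suc N) ((u , v) ∷ es) with u ≟ v
... | yes _ = quot (suc N) es
... | no u≢v = proj₁ r , proj₂ r ∘ merge u≢v
  where r = quot N (Vec.map (mapPair (merge u≢v)) es)

pick : {A : Set} (es : List A) → Subset (length es) → List A × List A
pick [] [] = [] , []
pick (e ∷ es) (b ∷ F) with pick es F
... | (ins , outs) = if b then (e ∷ ins , outs) else (ins , e ∷ outs)

contract : (G : Graph) → Subset (length (edges G)) → Graph
contract G F = graph (proj₁ q) (map (mapPair (proj₂ q)) (proj₂ p))
  where
  p = pick (edges G) F
  q = quot (N G) (Vec.fromList (proj₁ p))

{-# OPTIONS --safe #-}
module Submission where

-- Number the xor-blocks of rPar(n, σ) from 0, first the n - 2 blocks of Parity(X, S, id), then those of
-- Parity(X', T, σ). In the linear encoding of literals y₀ … yₙ₋₁ the first two and the last two literals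
-- share a block, every other literal yₖ lies in block k - 1 alone, and the j-th Tseitin variable joins
-- blocks j and j + 1. Hence x_i joins S-block blockOf i to T-block blockOf (σ⁻¹ i), and the Tseitin
-- variables of each encoding form a path through its blocks. The map sending vertex i of G_σ to S-block
-- blockOf i and vertex i' to T-block blockOf (σ⁻¹ i) therefore identifies exactly the endpoints of the
-- first and the last edge of each of the two paths of G_σ, so it induces a bijection from the graph
-- obtained by contracting these four edges; it sends the matching edge (i, i') to x_i and the inner
-- path edges to the Tseitin variables, which is the claimed isomorphism.

open import Defs
open import Data.Nat using (ℕ; _≤_)
open import Data.Fin.Subset using (Subset; ∣_∣)
open import Data.Fin.Permutation using (Permutation′)
open import Data.List using (length)
open import Data.Maybe using (just)
open import Data.Product using (Σ; _×_)
open import Relation.Binary.PropositionalEquality using (_≡_)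

open import Data.Bool using (Bool; true; false; T; T?; not; if_then_else_)
open import Data.Bool.Properties using (T-∨; T-≡; ∨-identityʳ)
open import Data.Empty using (⊥-elim)
open import Data.Fin using (Fin; zero; suc; fromℕ; fromℕ<; inject₁; toℕ; cast; pinch; punchIn; _≟_;
                            _↑ˡ_; _↑ʳ_; join; splitAt)
open import Data.Fin.Permutation using (_⟨$⟩ʳ_; _⟨$⟩ˡ_; inverseˡ; inverseʳ)
open import Data.Fin.Properties
  using (toℕ-injective; toℕ<n; toℕ-fromℕ<; toℕ-cast; toℕ-inject₁; toℕ-↑ˡ; toℕ-↑ʳ; cast-involutive;
         splitAt-join; join-splitAt; punchOut-cong; punchOut-punchIn; punchIn-punchOut; punchInᵢ≢i)
open import Data.Fin.Subset using (⊥; inside; outside)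
open import Data.Fin.Subset.Properties using (∣⊥∣≡0)
open import Data.List using (List; []; _∷_; _++_; [_]; _∷ʳ_; map; lookup; tabulate; allFin; concatMap;
                             filter; filterᵇ; deduplicate)
open import Data.List.Properties using (length-map; length-++; map-id; map-∘; map-cong; map-++; map-tabulate;
                                        map-injective; ++-identityʳ)
open import Data.List.Membership.Propositional using (_∈_)
open import Data.List.Membership.Propositional.Properties
  using (∈-lookup; ∈-tabulate⁺; ∈-tabulate⁻; ∈-map⁺; ∈-map⁻; ∈-++⁺ˡ; ∈-++⁺ʳ; ∈-++⁻; ∈-allFin)
open import Data.List.Relation.Binary.Pointwise using (Pointwise; []; _∷_; Pointwise-≡⇒≡)
import Data.List.Relation.Binary.Pointwise as Pointwise
import Data.List.Relation.Binary.Pointwise.Properties as Pointwise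
open import Data.List.Relation.Unary.All using ([]; _∷_)
import Data.List.Relation.Unary.All as List
import Data.List.Relation.Unary.All.Properties as List
open import Data.List.Relation.Unary.AllPairs using (_∷_)
open import Data.List.Relation.Unary.Any using (Any; here; there; index)
import Data.List.Relation.Unary.Any as Any
import Data.List.Relation.Unary.Any.Properties as Any
open import Data.List.Relation.Unary.Any.Properties using (lookup-index)
open import Data.List.Relation.Unary.Unique.Propositional using (Unique)
import Data.List.Relation.Unary.Unique.Propositional.Properties as Unique
open import Data.List.Relation.Unary.Unique.DecPropositional.Properties using (deduplicate-!)
open import Data.Maybe using (Maybe; fromMaybe)
open import Data.Nat using (zero; suc; _+_; _<_; _≡ᵇ_; z≤n; s≤s; s≤s⁻¹)
import Data.Nat.Properties as ℕ
open import Data.Product using (_,_; proj₁; proj₂; zip)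
open import Data.Sum using (_⊎_; inj₁; inj₂)
import Data.Sum as Sum
open import Data.Vec using (Vec; []; _∷_; fromList)
import Data.Vec as Vec
open import Data.Vec.Functional using (Vector; tail)
open import Data.Vec.Relation.Unary.All using (All; []; _∷_)
import Data.Vec.Relation.Unary.All as All
import Data.Vec.Relation.Unary.All.Properties as All
open import Function using (id; _∘_; _$_)
open import Function.Bundles using (_↔_; _⇔_; Inverse; Equivalence; mk↔ₛ′; mk⇔)
open import Function.Properties.Inverse using (↔-sym; ↔-trans)
open import Level using (0ℓ)
open import Relation.Binary.Definitions using (DecidableEquality)
open import Relation.Binary.PropositionalEquality using (_≢_; _≗_; refl; sym; trans; cong; cong₂; subst;
                                                        module ≡-Reasoning)
open import Relation.Nullary using (¬_; yes; no; does; contradiction; ¬?)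
import Relation.Nullary.Decidable as Dec
open import Relation.Nullary.Decidable using (does-⇔; dec-false)
open import Relation.Unary using (Pred; Decidable)

variable
  A B C : Set

Reindexing : (A → B) → List A → List B → Set
Reindexing F xs ys =
  Σ (Fin (length xs) ↔ Fin (length ys)) λ π → ∀ i → lookup ys (Inverse.to π i) ≡ F (lookup xs i)

module _ (f : A → B) where

  map-index↔ : (xs : List A) → Fin (length (map f xs)) ↔ Fin (length xs)
  map-index↔ xs =
    mk↔ₛ′ (cast eq) (cast (sym eq)) (cast-involutive eq (sym eq)) (cast-involutive (sym eq) eq)
    where eq = length-map f xs

  lookup-map : (xs : List A) (i : Fin (length (map f xs))) →
               lookup (map f xs) i ≡ f (lookup xs (Inverse.to (map-index↔ xs) i))
  lookup-map (x ∷ xs) zero    = refl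
  lookup-map (x ∷ xs) (suc i) = lookup-map xs i

Reindexing-mapʳ : {F : A → B} {xs : List A} {ys : List B} (G : B → C) →
                  Reindexing F xs ys → Reindexing (G ∘ F) xs (map G ys)
Reindexing-mapʳ {F = F} {xs} {ys} G (π , lookup-π) = ↔-trans π (↔-sym (map-index↔ G ys)) , λ i → begin
  lookup (map G ys) (from (map-index↔ G ys) (to π i))                    ≡⟨ lookup-map G ys _ ⟩
  G (lookup ys (to (map-index↔ G ys) (from (map-index↔ G ys) (to π i))))
    ≡⟨ cong (G ∘ lookup ys) (strictlyInverseˡ (map-index↔ G ys) (to π i)) ⟩
  G (lookup ys (to π i))                                                 ≡⟨ cong G (lookup-π i) ⟩
  G (F (lookup xs i))                                                    ∎
  where open ≡-Reasoning; open Inverse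

Reindexing-mapˡ : {F : B → C} {xs : List A} {ys : List C} (g : A → B) →
                  Reindexing (F ∘ g) xs ys → Reindexing F (map g xs) ys
Reindexing-mapˡ {F = F} {xs} g (π , lookup-π) =
  ↔-trans (map-index↔ g xs) π , λ i → trans (lookup-π _) (cong F (sym (lookup-map g xs i)))

lookup-injective : {xs : List A} → Unique xs → ∀ i j → lookup xs i ≡ lookup xs j → i ≡ j
lookup-injective (_ ∷ _)      zero    zero    _ = refl
lookup-injective (x≢ ∷ _)     zero    (suc j) e = ⊥-elim (List.lookup x≢ (∈-lookup j) e)
lookup-injective (x≢ ∷ _)     (suc i) zero    e = ⊥-elim (List.lookup x≢ (∈-lookup i) (sym e))
lookup-injective (_ ∷ unique) (suc i) (suc j) e = cong suc (lookup-injective unique i j e)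

Reindexing-unique : {xs ys : List A} → Unique xs → Unique ys →
                    (∀ {x} → x ∈ xs → x ∈ ys) → (∀ {y} → y ∈ ys → y ∈ xs) → Reindexing id xs ys
Reindexing-unique {xs = xs} {ys} unique-xs unique-ys xs⊆ys ys⊆xs =
  mk↔ₛ′ to from to-from from-to , lookup-to
  where
  to : Fin (length xs) → Fin (length ys)
  to i = index (xs⊆ys (∈-lookup i))
  from : Fin (length ys) → Fin (length xs)
  from j = index (ys⊆xs (∈-lookup j))
  lookup-to : ∀ i → lookup ys (to i) ≡ lookup xs i
  lookup-to i = sym (lookup-index (xs⊆ys (∈-lookup i)))
  lookup-from : ∀ j → lookup xs (from j) ≡ lookup ys j
  lookup-from j = sym (lookup-index (ys⊆xs (∈-lookup j)))
  to-from : ∀ j → to (from j) ≡ j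
  to-from j = lookup-injective unique-ys _ _ (trans (lookup-to (from j)) (lookup-from j))
  from-to : ∀ i → from (to i) ≡ i
  from-to i = lookup-injective unique-xs _ _ (trans (lookup-from (to i)) (lookup-to i))

Pointwise-∈ : {R : A → B → Set} {xs : List A} {ys : List B} →
              Pointwise R xs ys → ∀ {x} → x ∈ xs → Σ B (R x)
Pointwise-∈ (Rxy ∷ _)   (here refl) = _ , Rxy
Pointwise-∈ (_ ∷ Rxsys) (there x∈)  = Pointwise-∈ Rxsys x∈

module _ {A : Set} where

  subset-++ : (xs ys : List A) → Subset (length xs) → Subset (length ys) → Subset (length (xs ++ ys))
  subset-++ []       ys []      w = w
  subset-++ (x ∷ xs) ys (b ∷ u) w = b ∷ subset-++ xs ys u w

  lastOnly : (xs : List A) → Subset (length xs)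
  lastOnly []               = []
  lastOnly (_ ∷ [])         = inside ∷ []
  lastOnly (_ ∷ xs@(_ ∷ _)) = outside ∷ lastOnly xs

  endsOnly : (xs : List A) → Subset (length xs)
  endsOnly []       = []
  endsOnly (_ ∷ xs) = inside ∷ lastOnly xs

  pick-subset-++ : (xs ys : List A) (u : Subset (length xs)) (w : Subset (length ys)) →
                   pick (xs ++ ys) (subset-++ xs ys u w) ≡ zip _++_ _++_ (pick xs u) (pick ys w)
  pick-subset-++ []       ys []            w = refl
  pick-subset-++ (x ∷ xs) ys (inside ∷ u)  w rewrite pick-subset-++ xs ys u w = refl
  pick-subset-++ (x ∷ xs) ys (outside ∷ u) w rewrite pick-subset-++ xs ys u w = refl

  pick-⊥ : (xs : List A) → pick xs ⊥ ≡ ([] , xs)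
  pick-⊥ []       = refl
  pick-⊥ (x ∷ xs) rewrite pick-⊥ xs = refl

  pick-lastOnly : (xs : List A) (z : A) → pick (xs ∷ʳ z) (lastOnly (xs ∷ʳ z)) ≡ ([ z ] , xs)
  pick-lastOnly []           z = refl
  pick-lastOnly (x ∷ [])     z = refl
  pick-lastOnly (x ∷ y ∷ xs) z rewrite pick-lastOnly (y ∷ xs) z = refl

  pick-endsOnly : {es : List A} (x : A) (xs : List A) (z : A) → es ≡ x ∷ xs ∷ʳ z →
                  pick es (endsOnly es) ≡ (x ∷ z ∷ [] , xs)
  pick-endsOnly x xs z refl rewrite pick-lastOnly xs z = refl

  ∣subset-++∣ : (xs ys : List A) (u : Subset (length xs)) (w : Subset (length ys)) →
                ∣ subset-++ xs ys u w ∣ ≡ ∣ u ∣ + ∣ w ∣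
  ∣subset-++∣ []       ys []            w = refl
  ∣subset-++∣ (x ∷ xs) ys (inside ∷ u)  w = cong suc (∣subset-++∣ xs ys u w)
  ∣subset-++∣ (x ∷ xs) ys (outside ∷ u) w = ∣subset-++∣ xs ys u w

  ∣lastOnly∣ : (xs : List A) (z : A) → ∣ lastOnly (xs ∷ʳ z) ∣ ≡ 1
  ∣lastOnly∣ []           z = refl
  ∣lastOnly∣ (x ∷ [])     z = refl
  ∣lastOnly∣ (x ∷ y ∷ xs) z = ∣lastOnly∣ (y ∷ xs) z

  ∣endsOnly∣ : {es : List A} (x : A) (xs : List A) (z : A) → es ≡ x ∷ xs ∷ʳ z → ∣ endsOnly es ∣ ≡ 2
  ∣endsOnly∣ x xs z refl = cong suc (∣lastOnly∣ xs z)

  consecutive-tabulate : ∀ {k} (f : Fin (suc k) → A) →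
                         consecutive (tabulate f) ≡ tabulate (λ i → f (inject₁ i) , f (suc i))
  consecutive-tabulate {zero}  f = refl
  consecutive-tabulate {suc k} f = cong (_ ∷_) (consecutive-tabulate (tail f))

  tabulate-∷ʳ : ∀ {k} (f : Fin (suc k) → A) → tabulate f ≡ tabulate (f ∘ inject₁) ∷ʳ f (fromℕ k)
  tabulate-∷ʳ {zero}  f = refl
  tabulate-∷ʳ {suc k} f = cong (f zero ∷_) (tabulate-∷ʳ (tail f))

Identifies : (A → B) → List (A × A) → Set
Identifies q = List.All (λ e → q (proj₁ e) ≡ q (proj₂ e))

pinch-fromℕ-inject₁ : ∀ k (j : Fin (suc k)) → pinch (fromℕ k) (inject₁ j) ≡ j
pinch-fromℕ-inject₁ zero    zero    = refl
pinch-fromℕ-inject₁ (suc k) zero    = refl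
pinch-fromℕ-inject₁ (suc k) (suc j) = cong suc (pinch-fromℕ-inject₁ k j)

pinch-fromℕ-fromℕ : ∀ k → pinch (fromℕ k) (fromℕ (suc k)) ≡ fromℕ k
pinch-fromℕ-fromℕ zero    = refl
pinch-fromℕ-fromℕ (suc k) = cong suc (pinch-fromℕ-fromℕ k)

inject₁-pinch-fromℕ : ∀ k (j : Fin (suc (suc k))) →
                      inject₁ (pinch (fromℕ k) j) ≡ j ⊎ j ≡ fromℕ (suc k)
inject₁-pinch-fromℕ zero    zero       = inj₁ refl
inject₁-pinch-fromℕ zero    (suc zero) = inj₂ refl
inject₁-pinch-fromℕ (suc k) zero       = inj₁ refl
inject₁-pinch-fromℕ (suc k) (suc j)    = Sum.map (cong suc) (cong suc) (inject₁-pinch-fromℕ k j)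

module _ {m : ℕ} where

  -- blockOf i is the block containing the i-th literal in a linear encoding of 4 + m literals.
  blockOf : Fin (4 + m) → Fin (2 + m)
  blockOf zero          = zero
  blockOf (suc zero)    = zero
  blockOf (suc (suc i)) = suc (pinch (fromℕ m) i)

  liftBlock : Fin (2 + m) → Fin (4 + m)
  liftBlock b = suc (inject₁ b)

  blockOf-liftBlock : ∀ b → blockOf (liftBlock b) ≡ b
  blockOf-liftBlock zero    = refl
  blockOf-liftBlock (suc b) = cong suc (pinch-fromℕ-inject₁ m b)

  blockOf-last : blockOf (liftBlock (fromℕ (suc m))) ≡ blockOf (fromℕ (3 + m))
  blockOf-last = trans (blockOf-liftBlock _) (cong suc (sym (pinch-fromℕ-fromℕ m)))

  module _ {A : Set} (f : Fin (4 + m) → A) where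

    path : List (A × A)
    path = consecutive (map f (allFin (4 + m)))

    firstEdge lastEdge : A × A
    firstEdge = f zero , f (liftBlock zero)
    lastEdge  = f (liftBlock (fromℕ (suc m))) , f (fromℕ (3 + m))

    innerEdge : Fin (suc m) → A × A
    innerEdge d = f (liftBlock (inject₁ d)) , f (liftBlock (suc d))

    endEdges innerEdges : List (A × A)
    endEdges   = firstEdge ∷ lastEdge ∷ []
    innerEdges = tabulate innerEdge

    path-shape : path ≡ firstEdge ∷ innerEdges ∷ʳ lastEdge
    path-shape = begin
      consecutive (map f (allFin _))              ≡⟨ cong consecutive (map-tabulate id f) ⟩
      consecutive (tabulate f)                    ≡⟨ consecutive-tabulate f ⟩
      tabulate (λ i → f (inject₁ i) , f (suc i))
        ≡⟨ cong (firstEdge ∷_) (tabulate-∷ʳ (λ i → f (inject₁ (suc i)) , f (suc (suc i)))) ⟩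
      firstEdge ∷ innerEdges ∷ʳ lastEdge          ∎
      where open ≡-Reasoning

    pick-path : pick path (endsOnly path) ≡ (endEdges , innerEdges)
    pick-path = pick-endsOnly firstEdge innerEdges lastEdge path-shape

    ∣endsOnly-path∣ : ∣ endsOnly path ∣ ≡ 2
    ∣endsOnly-path∣ = ∣endsOnly∣ firstEdge innerEdges lastEdge path-shape

    endEdges-identified : (h : A → B) (c : Fin (2 + m) → B) → (∀ i → h (f i) ≡ c (blockOf i)) →
                          Identifies h endEdges
    endEdges-identified h c h∘f≗c∘blockOf =
      trans (h∘f≗c∘blockOf zero) (sym (h∘f≗c∘blockOf (liftBlock zero))) ∷
      trans (h∘f≗c∘blockOf _) (trans (cong c blockOf-last) (sym (h∘f≗c∘blockOf _))) ∷ []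

    liftBlock-blockOf : (q : A → B) → Identifies q endEdges → ∀ i → q (f (liftBlock (blockOf i))) ≡ q (f i)
    liftBlock-blockOf q (first ∷ last ∷ []) zero          = sym first
    liftBlock-blockOf q (first ∷ last ∷ []) (suc zero)    = refl
    liftBlock-blockOf q (first ∷ last ∷ []) (suc (suc j)) with inject₁-pinch-fromℕ m j
    ... | inj₁ e    = cong (λ k → q (f (suc (suc k)))) e
    ... | inj₂ refl = trans (cong (λ b → q (f (liftBlock (suc b)))) (pinch-fromℕ-fromℕ m)) last

Identifiesᵛ : {N k : ℕ} → (Fin N → B) → Vec (Fin N × Fin N) k → Set
Identifiesᵛ q = All (λ e → q (proj₁ e) ≡ q (proj₂ e))

module _ {N : ℕ} {u v : Fin (suc N)} (u≢v : u ≢ v) where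

  merge-punchIn : ∀ y → merge u≢v (punchIn v y) ≡ y
  merge-punchIn y with punchIn v y ≟ v
  ... | yes e = contradiction e (punchInᵢ≢i v y)
  ... | no _  = trans (punchOut-cong v refl) (punchOut-punchIn v)

  merge-identifies : merge u≢v u ≡ merge u≢v v
  merge-identifies with u ≟ v | v ≟ v
  ... | yes u≡v | _      = contradiction u≡v u≢v
  ... | no _    | yes _  = punchOut-cong v refl
  ... | no _    | no v≢v = contradiction refl v≢v

  punchIn-merge : (q : Fin (suc N) → B) → q u ≡ q v → ∀ w → q (punchIn v (merge u≢v w)) ≡ q w
  punchIn-merge q qu≡qv w with w ≟ v
  ... | yes refl = trans (cong q (punchIn-punchOut _)) qu≡qv
  ... | no _     = cong q (punchIn-punchOut _)

  identifies-merge : ∀ {k} {es : Vec (Fin (suc N) × Fin (suc N)) k} (q : Fin (suc N) → B) → q u ≡ q v →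
                     Identifiesᵛ q es → Identifiesᵛ (q ∘ punchIn v) (Vec.map (mapPair (merge u≢v)) es)
  identifies-merge q qu≡qv =
    All.map⁺ ∘ All.map λ {e} qe → trans (back (proj₁ e)) (trans qe (sym (back (proj₂ e))))
    where back = punchIn-merge q qu≡qv

quot-surjective : ∀ N {k} (es : Vec (Fin N × Fin N) k) y → Σ (Fin N) λ x → proj₂ (quot N es) x ≡ y
quot-surjective N       []             y = y , refl
quot-surjective (suc N) ((u , v) ∷ es) y with u ≟ v
... | yes _  = quot-surjective (suc N) es y
... | no u≢v with quot-surjective N (Vec.map (mapPair (merge u≢v)) es) y
...   | x , qx≡y = punchIn v x ,
                   trans (cong (proj₂ (quot N (Vec.map (mapPair (merge u≢v)) es))) (merge-punchIn u≢v x)) qx≡y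

quot-identifies : ∀ N {k} (es : Vec (Fin N × Fin N) k) → Identifiesᵛ (proj₂ (quot N es)) es
quot-identifies N       []             = []
quot-identifies (suc N) ((u , v) ∷ es) with u ≟ v
... | yes refl = refl ∷ quot-identifies (suc N) es
... | no u≢v   = cong (proj₂ (quot N es′)) (merge-identifies u≢v) ∷ All.map⁻ (quot-identifies N es′)
  where es′ = Vec.map (mapPair (merge u≢v)) es

quot-lift : ∀ N {k} (es : Vec (Fin N × Fin N) k) (h : Fin N → B) → Identifiesᵛ h es →
            Σ (Fin (proj₁ (quot N es)) → B) λ h′ → ∀ x → h′ (proj₂ (quot N es) x) ≡ h x
quot-lift N       []             h _ = h , λ _ → refl
quot-lift (suc N) ((u , v) ∷ es) h (hu≡hv ∷ h-es) with u ≟ v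
... | yes _  = quot-lift (suc N) es h h-es
... | no u≢v with quot-lift N (Vec.map (mapPair (merge u≢v)) es) (h ∘ punchIn v)
                             (identifies-merge u≢v h hu≡hv h-es)
...   | h′ , h′-q = h′ , λ x → trans (h′-q (merge u≢v x)) (punchIn-merge u≢v h hu≡hv x)

module _ (G : Graph) (F : Subset (length (edges G))) where

  selected unselected : List (Fin (N G) × Fin (N G))
  selected   = proj₁ (pick (edges G) F)
  unselected = proj₂ (pick (edges G) F)

  quotient : Fin (N G) → Fin (N (contract G F))
  quotient = proj₂ (quot (N G) (fromList selected))

  -- quotient ∘ s is inverse to the map through which h factors on the quotient.
  contract-≅ : (T : Graph) (h : Fin (N G) → Fin (N T)) (s : Fin (N T) → Fin (N G)) →
               (∀ b → h (s b) ≡ b) →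
               Identifies h selected →
               (∀ x → quotient (s (h x)) ≡ quotient x) →
               Reindexing id (edges T) (map (mapPair h) unselected) →
               T ≅ contract G F
  contract-≅ T h s h-s h-selected quotient-s-h reindex =
    vertices , proj₁ edges↔ , λ i → inj₁ (cong proj₁ (proj₂ edges↔ i) , cong proj₂ (proj₂ edges↔ i))
    where
    h′ : Fin (N (contract G F)) → Fin (N T)
    h′ = proj₁ (quot-lift (N G) (fromList selected) h (All.fromList⁺ h-selected))

    h′-quotient : ∀ x → h′ (quotient x) ≡ h x
    h′-quotient = proj₂ (quot-lift (N G) (fromList selected) h (All.fromList⁺ h-selected))

    quotient-s-h′ : ∀ y → quotient (s (h′ y)) ≡ y
    quotient-s-h′ y with quot-surjective (N G) (fromList selected) y
    ... | x , refl = trans (cong (quotient ∘ s) (h′-quotient x)) (quotient-s-h x)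

    vertices : Fin (N T) ↔ Fin (N (contract G F))
    vertices = mk↔ₛ′ (quotient ∘ s) h′ quotient-s-h′ (λ b → trans (h′-quotient (s b)) (h-s b))

    images : map (mapPair (quotient ∘ s)) (map (mapPair h) unselected) ≡ map (mapPair quotient) unselected
    images = trans (sym (map-∘ unselected))
                   (map-cong (λ e → cong₂ _,_ (quotient-s-h (proj₁ e)) (quotient-s-h (proj₂ e))) unselected)

    edges↔ : Reindexing (mapPair (quotient ∘ s)) (edges T) (map (mapPair quotient) unselected)
    edges↔ = subst (Reindexing (mapPair (quotient ∘ s)) (edges T)) images
               (Reindexing-mapʳ {F = id} {xs = edges T} {ys = map (mapPair h) unselected}
                                (mapPair (quotient ∘ s)) reindex)

allJust-map : (f : A → Maybe B) (g : A → B) (xs : List A) →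
              (∀ {x} → x ∈ xs → f x ≡ just (g x)) → allJust (map f xs) ≡ just (map g xs)
allJust-map f g []       _   = refl
allJust-map f g (x ∷ xs) f≡g rewrite f≡g (here refl) | allJust-map f g xs (f≡g ∘ there) = refl

tseitinGraph-just : (φ : Formula) (g : Var → Fin (length φ) × Fin (length φ)) →
                    (∀ {v} → v ∈ varsOf φ → exactlyTwo (blocksContaining φ v) ≡ just (g v)) →
                    tseitinGraph φ ≡ just (graph (length φ) (map g (varsOf φ)))
tseitinGraph-just φ g two rewrite allJust-map _ g (varsOf φ) two = refl

xv-injective : ∀ {a b} → xv a ≡ xv b → a ≡ b
xv-injective refl = refl

sv-injective : ∀ {a b} → sv a ≡ sv b → a ≡ b
sv-injective refl = refl

tv-injective : ∀ {a b} → tv a ≡ tv b → a ≡ b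
tv-injective refl = refl

_≟ᵛ_ : DecidableEquality Var
xv a ≟ᵛ xv b = Dec.map′ (cong xv) xv-injective (a ℕ.≟ b)
sv a ≟ᵛ sv b = Dec.map′ (cong sv) sv-injective (a ℕ.≟ b)
tv a ≟ᵛ tv b = Dec.map′ (cong tv) tv-injective (a ℕ.≟ b)
xv _ ≟ᵛ sv _ = no λ ()
xv _ ≟ᵛ tv _ = no λ ()
sv _ ≟ᵛ xv _ = no λ ()
sv _ ≟ᵛ tv _ = no λ ()
tv _ ≟ᵛ xv _ = no λ ()
tv _ ≟ᵛ sv _ = no λ ()

does-≟ᵛ : ∀ v w → does (v ≟ᵛ w) ≡ (v == w)
does-≟ᵛ (xv _) (xv _) = refl
does-≟ᵛ (xv _) (sv _) = refl
does-≟ᵛ (xv _) (tv _) = refl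
does-≟ᵛ (sv _) (xv _) = refl
does-≟ᵛ (sv _) (sv _) = refl
does-≟ᵛ (sv _) (tv _) = refl
does-≟ᵛ (tv _) (xv _) = refl
does-≟ᵛ (tv _) (sv _) = refl
does-≟ᵛ (tv _) (tv _) = refl

==⇒≡ : ∀ v w → T (v == w) → v ≡ w
==⇒≡ (xv a) (xv b) t = cong xv (ℕ.≡ᵇ⇒≡ a b t)
==⇒≡ (sv a) (sv b) t = cong sv (ℕ.≡ᵇ⇒≡ a b t)
==⇒≡ (tv a) (tv b) t = cong tv (ℕ.≡ᵇ⇒≡ a b t)

==-refl : ∀ v → T (v == v)
==-refl (xv a) = ℕ.≡⇒≡ᵇ a a refl
==-refl (sv a) = ℕ.≡⇒≡ᵇ a a refl
==-refl (tv a) = ℕ.≡⇒≡ᵇ a a refl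

≢⇒≡ᵇfalse : ∀ a b → a ≢ b → (a ≡ᵇ b) ≡ false
≢⇒≡ᵇfalse a b = dec-false (a ℕ.≟ b)

filter-does : {P Q : Pred A 0ℓ} (P? : Decidable P) (Q? : Decidable Q) →
              (∀ x → does (P? x) ≡ does (Q? x)) → filter P? ≗ filter Q?
filter-does P? Q? same []       = refl
filter-does P? Q? same (x ∷ xs) with does (P? x) | does (Q? x) | same x
... | true  | .true  | refl = cong (x ∷_) (filter-does P? Q? same xs)
... | false | .false | refl = filter-does P? Q? same xs

varsOf-deduplicate : ∀ φ → varsOf φ ≡ deduplicate _≟ᵛ_ (concatMap (map proj₂) φ)
varsOf-deduplicate []            = refl
varsOf-deduplicate ([] ∷ φ)      = varsOf-deduplicate φ
varsOf-deduplicate ((l ∷ b) ∷ φ) = cong (proj₂ l ∷_) (begin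
  filterᵇ (λ w → not (proj₂ l == w)) (varsOf (b ∷ φ))
    ≡⟨ filter-does (T? ∘ λ w → not (proj₂ l == w)) (¬? ∘ (proj₂ l ≟ᵛ_))
                   (λ w → cong not (sym (does-≟ᵛ (proj₂ l) w))) (varsOf (b ∷ φ)) ⟩
  filter (¬? ∘ (proj₂ l ≟ᵛ_)) (varsOf (b ∷ φ))
    ≡⟨ cong (filter (¬? ∘ (proj₂ l ≟ᵛ_))) (varsOf-deduplicate (b ∷ φ)) ⟩
  filter (¬? ∘ (proj₂ l ≟ᵛ_)) (deduplicate _≟ᵛ_ (concatMap (map proj₂) (b ∷ φ))) ∎)
  where open ≡-Reasoning

varsOf-unique : ∀ φ → Unique (varsOf φ)
varsOf-unique φ = subst Unique (sym (varsOf-deduplicate φ)) (deduplicate-! _≟ᵛ_ _)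

occursIn⇒∈ : ∀ v b → T (occursIn v b) → v ∈ map proj₂ b
occursIn⇒∈ v (l ∷ b) t with Equivalence.to T-∨ t
... | inj₁ l≡v = here (sym (==⇒≡ _ _ l≡v))
... | inj₂ t′  = there (occursIn⇒∈ v b t′)

∈⇒occursIn : ∀ v b → v ∈ map proj₂ b → T (occursIn v b)
∈⇒occursIn v (l ∷ b) (here refl) = Equivalence.from T-∨ (inj₁ (==-refl v))
∈⇒occursIn v (l ∷ b) (there v∈)  = Equivalence.from T-∨ (inj₂ (∈⇒occursIn v b v∈))

∈-varsOf⇔ : ∀ {v} φ → v ∈ varsOf φ ⇔ Any (T ∘ occursIn v) φ
∈-varsOf⇔ {v} φ = mk⇔
  (λ v∈ → Any.map (∈⇒occursIn v _) (Any.map⁻ (Any.concat⁻ (map (map proj₂) φ)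
            (Any.deduplicate⁻ _≟ᵛ_ (subst (v ∈_) (varsOf-deduplicate φ) v∈)))))
  (λ occ → subst (v ∈_) (sym (varsOf-deduplicate φ))
            (Any.deduplicate⁺ _≟ᵛ_ (λ y≡x v≡x → trans v≡x (sym y≡x))
              (Any.concat⁺ (Any.map⁺ (Any.map (occursIn⇒∈ v _) occ)))))

indicesᵇ : (A → Bool) → List A → List ℕ
indicesᵇ p []       = []
indicesᵇ p (x ∷ xs) = (if p x then 0 ∷_ else id) (map suc (indicesᵇ p xs))

module _ (p : A → Bool) where

  Any⇒indicesᵇ≢[] : ∀ {xs} → Any (T ∘ p) xs → indicesᵇ p xs ≢ []
  Any⇒indicesᵇ≢[] {x ∷ xs} (here px) with p x
  ... | true  = λ ()
  ... | false = ⊥-elim px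
  Any⇒indicesᵇ≢[] {x ∷ xs} (there pxs) with p x | indicesᵇ p xs | Any⇒indicesᵇ≢[] pxs
  ... | true  | _     | _   = λ ()
  ... | false | []    | ≢[] = contradiction refl ≢[]
  ... | false | _ ∷ _ | _   = λ ()

  indicesᵇ≢[]⇒Any : ∀ xs → indicesᵇ p xs ≢ [] → Any (T ∘ p) xs
  indicesᵇ≢[]⇒Any []       ≢[] = contradiction refl ≢[]
  indicesᵇ≢[]⇒Any (x ∷ xs) ≢[] with p x in px
  ... | true  = here (Equivalence.from T-≡ px)
  ... | false = there (indicesᵇ≢[]⇒Any xs (λ e → ≢[] (cong (map suc) e)))

  indicesᵇ-++ : ∀ xs ys → indicesᵇ p (xs ++ ys) ≡ indicesᵇ p xs ++ map (length xs +_) (indicesᵇ p ys)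
  indicesᵇ-++ []       ys = sym (map-id (indicesᵇ p ys))
  indicesᵇ-++ (x ∷ xs) ys = begin
    cons? (map suc (indicesᵇ p (xs ++ ys)))
      ≡⟨ cong (cons? ∘ map suc) (indicesᵇ-++ xs ys) ⟩
    cons? (map suc (indicesᵇ p xs ++ map (length xs +_) (indicesᵇ p ys)))
      ≡⟨ cong cons? (map-++ suc (indicesᵇ p xs) _) ⟩
    cons? (map suc (indicesᵇ p xs) ++ map suc (map (length xs +_) (indicesᵇ p ys)))
      ≡⟨ cong (λ is → cons? (map suc (indicesᵇ p xs) ++ is)) (sym (map-∘ (indicesᵇ p ys))) ⟩
    cons? (map suc (indicesᵇ p xs) ++ map (suc (length xs) +_) (indicesᵇ p ys))
      ≡⟨ cons?-++ (p x) ⟩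
    cons? (map suc (indicesᵇ p xs)) ++ map (suc (length xs) +_) (indicesᵇ p ys) ∎
    where
    open ≡-Reasoning
    cons? : List ℕ → List ℕ
    cons? = if p x then 0 ∷_ else id
    cons?-++ : ∀ b {is js} → (if b then 0 ∷_ else id) (is ++ js) ≡ (if b then 0 ∷_ else id) is ++ js
    cons?-++ true  = refl
    cons?-++ false = refl

filterᵇ-map : (q : B → Bool) (f : A → B) (xs : List A) → filterᵇ q (map f xs) ≡ map f (filterᵇ (q ∘ f) xs)
filterᵇ-map q f []       = refl
filterᵇ-map q f (x ∷ xs) with q (f x)
... | true  = cong (f x ∷_) (filterᵇ-map q f xs)
... | false = filterᵇ-map q f xs

toℕ-filterᵇ-suc : ∀ {k} (q : Fin (suc k) → Bool) →
                  map toℕ (filterᵇ q (tabulate suc)) ≡ map suc (map toℕ (filterᵇ (tail q) (allFin k)))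
toℕ-filterᵇ-suc {k} q = begin
  map toℕ (filterᵇ q (tabulate suc))
    ≡⟨ cong (map toℕ ∘ filterᵇ q) (sym (map-tabulate id suc)) ⟩
  map toℕ (filterᵇ q (map suc (allFin k)))         ≡⟨ cong (map toℕ) (filterᵇ-map q suc (allFin k)) ⟩
  map toℕ (map suc (filterᵇ (tail q) (allFin k)))  ≡⟨ sym (map-∘ _) ⟩
  map (suc ∘ toℕ) (filterᵇ (tail q) (allFin k))    ≡⟨ map-∘ _ ⟩
  map suc (map toℕ (filterᵇ (tail q) (allFin k)))  ∎
  where open ≡-Reasoning

toℕ-filterᵇ-lookup : (p : A → Bool) (xs : List A) →
                     map toℕ (filterᵇ (p ∘ lookup xs) (allFin (length xs))) ≡ indicesᵇ p xs
toℕ-filterᵇ-lookup p []       = refl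
toℕ-filterᵇ-lookup p (x ∷ xs) with p x
... | true  = cong (0 ∷_) shifted
  where shifted = trans (toℕ-filterᵇ-suc (p ∘ lookup (x ∷ xs))) (cong (map suc) (toℕ-filterᵇ-lookup p xs))
... | false = trans (toℕ-filterᵇ-suc (p ∘ lookup (x ∷ xs))) (cong (map suc) (toℕ-filterᵇ-lookup p xs))

toℕ-blocksContaining : ∀ φ v → map toℕ (blocksContaining φ v) ≡ indicesᵇ (occursIn v) φ
toℕ-blocksContaining φ v = toℕ-filterᵇ-lookup (occursIn v) φ

xLits : ∀ {k} → Vector Bool k → Vector ℕ k → List Lit
xLits pol π = tabulate λ i → pol i , xv (π i)

record Fresh (fr : ℕ → Var) : Set where
  field
    fr-== : ∀ j k → (fr j == fr k) ≡ (j ≡ᵇ k)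
    fr-xv : ∀ j a → (fr j == xv a) ≡ false
    xv-fr : ∀ a j → (xv a == fr j) ≡ false

open Fresh

Fresh-suc : ∀ {fr} → Fresh fr → Fresh (fr ∘ suc)
Fresh-suc F = record { fr-== = λ j k → fr-== F (suc j) (suc k)
                     ; fr-xv = λ j → fr-xv F (suc j)
                     ; xv-fr = λ a j → xv-fr F a (suc j) }

Fresh-sv : Fresh sv
Fresh-sv = record { fr-== = λ _ _ → refl ; fr-xv = λ _ _ → refl ; xv-fr = λ _ _ → refl }

Fresh-tv : Fresh tv
Fresh-tv = record { fr-== = λ _ _ → refl ; fr-xv = λ _ _ → refl ; xv-fr = λ _ _ → refl }

linChain-shift : ∀ fr j ys → linChain fr (suc j) ys ≡ linChain (fr ∘ suc) j ys
linChain-shift fr j []               = refl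
linChain-shift fr j (a ∷ [])         = refl
linChain-shift fr j (a ∷ b ∷ [])     = refl
linChain-shift fr j (a ∷ b ∷ c ∷ ys) = cong (_ ∷_) (linChain-shift fr (suc j) (b ∷ c ∷ ys))

freshBlocks : ℕ → List ℕ
freshBlocks zero    = [ 0 ]
freshBlocks (suc d) = d ∷ suc d ∷ []

freshBlocks-suc : ∀ d → (if 0 ≡ᵇ d then 0 ∷_ else id) (map suc (freshBlocks d)) ≡ freshBlocks (suc d)
freshBlocks-suc zero    = refl
freshBlocks-suc (suc d) = refl

chain-absent : ∀ L fr (pol : Vector Bool (2 + L)) π v →
               (∀ d → d ≤ L → (fr d == v) ≡ false) → (∀ k → (xv (π k) == v) ≡ false) →
               indicesᵇ (occursIn v) (linChain fr 0 (xLits pol π)) ≡ []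
chain-absent zero    fr pol π v fr≢v xv≢v rewrite fr≢v 0 z≤n | xv≢v zero | xv≢v (suc zero) = refl
chain-absent (suc L) fr pol π v fr≢v xv≢v rewrite fr≢v 0 z≤n | xv≢v zero | fr≢v 1 (s≤s z≤n)
  | linChain-shift fr 0 (xLits (tail pol) (tail π)) =
  cong (map suc) (chain-absent L (fr ∘ suc) (tail pol) (tail π) v
                   (λ d d≤L → fr≢v (suc d) (s≤s d≤L)) (λ k → xv≢v (suc k)))

chain-x : ∀ L {fr} → Fresh fr → (pol : Vector Bool (2 + L)) (π : Vector ℕ (2 + L)) (a : ℕ) (i : Fin (2 + L)) →
          (∀ k → (π k ≡ᵇ a) ≡ does (k ≟ i)) →
          indicesᵇ (occursIn (xv a)) (linChain fr 0 (xLits pol π)) ≡ [ toℕ (pinch (fromℕ L) i) ]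
chain-x zero    F pol π a zero       π≡a rewrite fr-xv F 0 a | π≡a zero = refl
chain-x zero    F pol π a (suc zero) π≡a rewrite fr-xv F 0 a | π≡a zero | π≡a (suc zero) = refl
chain-x (suc L) {fr} F pol π a zero π≡a rewrite fr-xv F 0 a | π≡a zero
  | linChain-shift fr 0 (xLits (tail pol) (tail π)) =
  cong (λ is → 0 ∷ map suc is)
       (chain-absent L (fr ∘ suc) (tail pol) (tail π) (xv a) (λ d _ → fr-xv F (suc d) a) (λ k → π≡a (suc k)))
chain-x (suc L) {fr} F pol π a (suc i) π≡a rewrite fr-xv F 0 a | π≡a zero | fr-xv F 1 a
  | linChain-shift fr 0 (xLits (tail pol) (tail π)) =
  cong (map suc) (chain-x L (Fresh-suc F) (tail pol) (tail π) a i (λ k → π≡a (suc k)))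

chain-fresh : ∀ L {fr} → Fresh fr → (pol : Vector Bool (2 + L)) (π : Vector ℕ (2 + L)) (d : ℕ) → d ≤ L →
              indicesᵇ (occursIn (fr d)) (linChain fr 0 (xLits pol π)) ≡ freshBlocks d
chain-fresh zero    F pol π zero z≤n rewrite fr-== F 0 0 = refl
chain-fresh (suc L) {fr} F pol π zero z≤n rewrite fr-== F 0 0
  | linChain-shift fr 0 (xLits (tail pol) (tail π)) =
  cong (λ is → 0 ∷ map suc is)
       (chain-absent L (fr ∘ suc) (tail pol) (tail π) (fr 0) (λ d _ → fr-== F (suc d) 0) (λ k → xv-fr F _ 0))
chain-fresh (suc L) {fr} F pol π (suc d) (s≤s d≤L) rewrite fr-== F 0 (suc d) | xv-fr F (π zero) (suc d)
  | fr-== F 1 (suc d) | ∨-identityʳ (0 ≡ᵇ d) | linChain-shift fr 0 (xLits (tail pol) (tail π))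
  | chain-fresh L (Fresh-suc F) (tail pol) (tail π) d d≤L = freshBlocks-suc d

encoding : ∀ m → (ℕ → Var) → Vector Bool (4 + m) → Vector ℕ (4 + m) → Formula
encoding m fr pol π = linEnc fr (xLits pol π)

encoding-absent : ∀ m fr pol π v →
                  (∀ d → d ≤ m → (fr d == v) ≡ false) → (∀ k → (xv (π k) == v) ≡ false) →
                  indicesᵇ (occursIn v) (encoding m fr pol π) ≡ []
encoding-absent m fr pol π v fr≢v xv≢v rewrite xv≢v zero | xv≢v (suc zero) | fr≢v 0 z≤n =
  cong (map suc) (chain-absent m fr (tail (tail pol)) (tail (tail π)) v fr≢v (λ k → xv≢v (suc (suc k))))

encoding-x : ∀ m {fr} → Fresh fr → ∀ pol π a i → (∀ k → (π k ≡ᵇ a) ≡ does (k ≟ i)) →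
             indicesᵇ (occursIn (xv a)) (encoding m fr pol π) ≡ [ toℕ (blockOf i) ]
encoding-x m {fr} F pol π a zero π≡a rewrite π≡a zero =
  cong (λ is → 0 ∷ map suc is)
       (chain-absent m fr (tail (tail pol)) (tail (tail π)) (xv a) (λ d _ → fr-xv F d a) (λ k → π≡a (suc (suc k))))
encoding-x m {fr} F pol π a (suc zero) π≡a rewrite π≡a zero | π≡a (suc zero) =
  cong (λ is → 0 ∷ map suc is)
       (chain-absent m fr (tail (tail pol)) (tail (tail π)) (xv a) (λ d _ → fr-xv F d a) (λ k → π≡a (suc (suc k))))
encoding-x m F pol π a (suc (suc i)) π≡a rewrite π≡a zero | π≡a (suc zero) | fr-xv F 0 a =
  cong (map suc) (chain-x m F (tail (tail pol)) (tail (tail π)) a i (λ k → π≡a (suc (suc k))))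

encoding-fresh : ∀ m {fr} → Fresh fr → ∀ pol π d → d ≤ m →
                 indicesᵇ (occursIn (fr d)) (encoding m fr pol π) ≡ d ∷ suc d ∷ []
encoding-fresh m {fr} F pol π d d≤m rewrite xv-fr F (π zero) d | xv-fr F (π (suc zero)) d | fr-== F 0 d
  | ∨-identityʳ (0 ≡ᵇ d) =
  trans (cong (λ is → (if 0 ≡ᵇ d then 0 ∷_ else id) (map suc is))
              (chain-fresh m F (tail (tail pol)) (tail (tail π)) d d≤m))
        (freshBlocks-suc d)

length-linChain : ∀ L fr j (pol : Vector Bool (2 + L)) π → length (linChain fr j (xLits pol π)) ≡ suc L
length-linChain zero    fr j pol π = refl
length-linChain (suc L) fr j pol π = cong suc (length-linChain L fr (suc j) (tail pol) (tail π))

length-encoding : ∀ m fr pol π → length (encoding m fr pol π) ≡ 2 + m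
length-encoding m fr pol π = cong suc (length-linChain m fr 0 (tail (tail pol)) (tail (tail π)))

module TseitinGraphOfRPar (m : ℕ) (σ : Permutation′ (4 + m)) where

  n M : ℕ
  n = 4 + m
  M = 2 + m

  φ : Formula
  φ = rPar n σ

  polS polT : Fin n → Bool
  polS _ = true
  polT i = not (suc (toℕ (σ ⟨$⟩ʳ i)) ≡ᵇ n)

  πS πT : Fin n → ℕ
  πS = toℕ
  πT = toℕ ∘ (σ ⟨$⟩ʳ_)

  φS φT : Formula
  φS = encoding m sv polS πS
  φT = encoding m tv polT πT

  φ≡φS++φT : φ ≡ φS ++ φT
  φ≡φS++φT = cong₂ _++_ (cong (linEnc sv) (map-tabulate id (litX {n})))
                        (cong (linEnc tv) (map-tabulate id (litX' {n} ∘ (σ ⟨$⟩ʳ_))))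

  length-φ : length φ ≡ M + M
  length-φ = begin
    length φ               ≡⟨ cong length φ≡φS++φT ⟩
    length (φS ++ φT)      ≡⟨ length-++ φS ⟩
    length φS + length φT  ≡⟨ cong₂ _+_ (length-encoding m sv polS πS) (length-encoding m tv polT πT) ⟩
    M + M                  ∎
    where open ≡-Reasoning

  blocks : Var → List ℕ
  blocks v = indicesᵇ (occursIn v) φ

  blocks-φS++φT : ∀ v {bs bs′} → indicesᵇ (occursIn v) φS ≡ bs → indicesᵇ (occursIn v) φT ≡ bs′ →
                  blocks v ≡ bs ++ map (M +_) bs′
  blocks-φS++φT v {bs} {bs′} inS inT = begin
    indicesᵇ (occursIn v) φ
      ≡⟨ cong (indicesᵇ (occursIn v)) φ≡φS++φT ⟩
    indicesᵇ (occursIn v) (φS ++ φT)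
      ≡⟨ indicesᵇ-++ (occursIn v) φS φT ⟩
    indicesᵇ (occursIn v) φS ++ map (length φS +_) (indicesᵇ (occursIn v) φT)
      ≡⟨ cong₂ (λ is k → is ++ map (k +_) (indicesᵇ (occursIn v) φT)) inS (length-encoding m sv polS πS) ⟩
    bs ++ map (M +_) (indicesᵇ (occursIn v) φT)
      ≡⟨ cong (λ is → bs ++ map (M +_) is) inT ⟩
    bs ++ map (M +_) bs′
      ∎
    where open ≡-Reasoning

  blocks-x : ∀ i → blocks (xv (toℕ i)) ≡ toℕ (blockOf i) ∷ M + toℕ (blockOf (σ ⟨$⟩ˡ i)) ∷ []
  blocks-x i = blocks-φS++φT (xv (toℕ i))
    (encoding-x m Fresh-sv polS πS (toℕ i) i λ k →
      does-⇔ (mk⇔ toℕ-injective (cong toℕ)) (toℕ k ℕ.≟ toℕ i) (k ≟ i))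
    (encoding-x m Fresh-tv polT πT (toℕ i) (σ ⟨$⟩ˡ i) λ k →
      does-⇔ (mk⇔ (σk≡i⇒k≡σ⁻¹i ∘ toℕ-injective) λ { refl → cong toℕ (inverseʳ σ) })
             (toℕ (σ ⟨$⟩ʳ k) ℕ.≟ toℕ i) (k ≟ σ ⟨$⟩ˡ i))
    where
    σk≡i⇒k≡σ⁻¹i : ∀ {k} → σ ⟨$⟩ʳ k ≡ i → k ≡ σ ⟨$⟩ˡ i
    σk≡i⇒k≡σ⁻¹i refl = sym (inverseˡ σ)

  blocks-s : ∀ d → d ≤ m → blocks (sv d) ≡ d ∷ suc d ∷ []
  blocks-s d d≤m = blocks-φS++φT (sv d) (encoding-fresh m Fresh-sv polS πS d d≤m)
                                        (encoding-absent m tv polT πT (sv d) (λ _ _ → refl) (λ _ → refl))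

  blocks-t : ∀ d → d ≤ m → blocks (tv d) ≡ M + d ∷ M + suc d ∷ []
  blocks-t d d≤m = blocks-φS++φT (tv d) (encoding-absent m sv polS πS (tv d) (λ _ _ → refl) (λ _ → refl))
                                        (encoding-fresh m Fresh-tv polT πT d d≤m)

  blocks-x-absent : ∀ a → n ≤ a → blocks (xv a) ≡ []
  blocks-x-absent a n≤a =
    blocks-φS++φT (xv a) (encoding-absent m sv polS πS (xv a) (λ _ _ → refl) out-of-range)
                         (encoding-absent m tv polT πT (xv a) (λ _ _ → refl) (out-of-range ∘ (σ ⟨$⟩ʳ_)))
    where
    out-of-range : ∀ (k : Fin n) → (toℕ k ≡ᵇ a) ≡ false
    out-of-range k = ≢⇒≡ᵇfalse (toℕ k) a λ { refl → ℕ.<⇒≱ (toℕ<n k) n≤a }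

  fresh-out-of-range : ∀ {d} → m < d → ∀ d′ → d′ ≤ m → (d′ ≡ᵇ d) ≡ false
  fresh-out-of-range m<d d′ d′≤m = ≢⇒≡ᵇfalse d′ _ λ { refl → ℕ.<⇒≱ m<d d′≤m }

  blocks-s-absent : ∀ d → m < d → blocks (sv d) ≡ []
  blocks-s-absent d m<d =
    blocks-φS++φT (sv d) (encoding-absent m sv polS πS (sv d) (fresh-out-of-range m<d) (λ _ → refl))
                         (encoding-absent m tv polT πT (sv d) (λ _ _ → refl) (λ _ → refl))

  blocks-t-absent : ∀ d → m < d → blocks (tv d) ≡ []
  blocks-t-absent d m<d =
    blocks-φS++φT (tv d) (encoding-absent m sv polS πS (tv d) (λ _ _ → refl) (λ _ → refl))
                         (encoding-absent m tv polT πT (tv d) (fresh-out-of-range m<d) (λ _ → refl))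

  -- Block b of φS is b ↑ˡ M and block b of φT is M ↑ʳ b.
  toBlock : Fin (M + M) → Fin (length φ)
  toBlock = cast (sym length-φ)

  blockOfˢ : Fin n ⊎ Fin n → Fin M ⊎ Fin M
  blockOfˢ = Sum.map blockOf (blockOf ∘ (σ ⟨$⟩ˡ_))

  liftBlockˢ : Fin M ⊎ Fin M → Fin n ⊎ Fin n
  liftBlockˢ = Sum.map liftBlock ((σ ⟨$⟩ʳ_) ∘ liftBlock)

  blockOfˢ-liftBlockˢ : ∀ z → blockOfˢ (liftBlockˢ z) ≡ z
  blockOfˢ-liftBlockˢ (inj₁ b) = cong inj₁ (blockOf-liftBlock b)
  blockOfˢ-liftBlockˢ (inj₂ b) = cong inj₂ (trans (cong blockOf (inverseˡ σ)) (blockOf-liftBlock b))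

  vertexBlock : Fin (n + n) → Fin (length φ)
  vertexBlock = toBlock ∘ join M M ∘ blockOfˢ ∘ splitAt n

  representative : Fin (length φ) → Fin (n + n)
  representative = join n n ∘ liftBlockˢ ∘ splitAt M ∘ cast length-φ

  vertexBlock-join : ∀ z → vertexBlock (join n n z) ≡ toBlock (join M M (blockOfˢ z))
  vertexBlock-join z = cong (toBlock ∘ join M M ∘ blockOfˢ) (splitAt-join n n z)

  representative-toBlock : ∀ z → representative (toBlock (join M M z)) ≡ join n n (liftBlockˢ z)
  representative-toBlock z = begin
    join n n (liftBlockˢ (splitAt M (cast length-φ (toBlock (join M M z)))))
      ≡⟨ cong (join n n ∘ liftBlockˢ ∘ splitAt M) (cast-involutive length-φ (sym length-φ) (join M M z)) ⟩
    join n n (liftBlockˢ (splitAt M (join M M z)))  ≡⟨ cong (join n n ∘ liftBlockˢ) (splitAt-join M M z) ⟩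
    join n n (liftBlockˢ z)                         ∎
    where open ≡-Reasoning

  vertexBlock-representative : ∀ b → vertexBlock (representative b) ≡ b
  vertexBlock-representative b = begin
    vertexBlock (join n n (liftBlockˢ z))             ≡⟨ vertexBlock-join (liftBlockˢ z) ⟩
    toBlock (join M M (blockOfˢ (liftBlockˢ z)))      ≡⟨ cong (toBlock ∘ join M M) (blockOfˢ-liftBlockˢ z) ⟩
    toBlock (join M M (splitAt M (cast length-φ b)))  ≡⟨ cong toBlock (join-splitAt M M (cast length-φ b)) ⟩
    toBlock (cast length-φ b)                         ≡⟨ cast-involutive (sym length-φ) length-φ b ⟩
    b                                                 ∎
    where
    open ≡-Reasoning
    z = splitAt M (cast length-φ b)

  representative-vertexBlock : ∀ z → representative (vertexBlock (join n n z)) ≡ join n n (liftBlockˢ (blockOfˢ z))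
  representative-vertexBlock z =
    trans (cong representative (vertexBlock-join z)) (representative-toBlock (blockOfˢ z))

  -- right i is the i-th vertex σ(i)′ of the second path of G_σ.
  left right : Fin n → Fin (n + n)
  left i  = i ↑ˡ n
  right i = n ↑ʳ (σ ⟨$⟩ʳ i)

  vertexBlock-right : ∀ i → vertexBlock (right i) ≡ toBlock (M ↑ʳ blockOf i)
  vertexBlock-right i =
    trans (vertexBlock-join (inj₂ (σ ⟨$⟩ʳ i))) (cong (toBlock ∘ (M ↑ʳ_) ∘ blockOf) (inverseˡ σ))

  toℕ-vertexBlock-↑ˡ : ∀ i → toℕ (vertexBlock (i ↑ˡ n)) ≡ toℕ (blockOf i)
  toℕ-vertexBlock-↑ˡ i =
    trans (cong toℕ (vertexBlock-join (inj₁ i))) (trans (toℕ-cast (sym length-φ) _) (toℕ-↑ˡ _ M))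

  toℕ-vertexBlock-↑ʳ : ∀ i → toℕ (vertexBlock (n ↑ʳ i)) ≡ M + toℕ (blockOf (σ ⟨$⟩ˡ i))
  toℕ-vertexBlock-↑ʳ i =
    trans (cong toℕ (vertexBlock-join (inj₂ i))) (trans (toℕ-cast (sym length-φ) _) (toℕ-↑ʳ M _))

  toℕ-vertexBlock-left : ∀ b → toℕ (vertexBlock (left (liftBlock b))) ≡ toℕ b
  toℕ-vertexBlock-left b = trans (toℕ-vertexBlock-↑ˡ (liftBlock b)) (cong toℕ (blockOf-liftBlock b))

  toℕ-vertexBlock-right : ∀ b → toℕ (vertexBlock (right (liftBlock b))) ≡ M + toℕ b
  toℕ-vertexBlock-right b = begin
    toℕ (vertexBlock (right (liftBlock b)))     ≡⟨ cong toℕ (vertexBlock-right (liftBlock b)) ⟩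
    toℕ (toBlock (M ↑ʳ blockOf (liftBlock b)))  ≡⟨ toℕ-cast (sym length-φ) _ ⟩
    toℕ (M ↑ʳ blockOf (liftBlock b))            ≡⟨ toℕ-↑ʳ M _ ⟩
    M + toℕ (blockOf (liftBlock b))             ≡⟨ cong (λ c → M + toℕ c) (blockOf-liftBlock b) ⟩
    M + toℕ b                                   ∎
    where open ≡-Reasoning

  matching : List (Fin (n + n) × Fin (n + n))
  matching = map (λ i → i ↑ˡ n , n ↑ʳ i) (allFin n)

  G : Graph
  G = Gσ n σ

  contractedʳ : Subset (length (path right ++ matching))
  contractedʳ = subset-++ (path right) matching (endsOnly (path right)) ⊥

  contracted : Subset (length (edges G))
  contracted = subset-++ (path left) (path right ++ matching) (endsOnly (path left)) contractedʳ

  ∣contracted∣ : ∣ contracted ∣ ≡ 4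
  ∣contracted∣ = begin
    ∣ contracted ∣
      ≡⟨ ∣subset-++∣ (path left) (path right ++ matching) (endsOnly (path left)) contractedʳ ⟩
    ∣ endsOnly (path left) ∣ + ∣ contractedʳ ∣
      ≡⟨ cong₂ _+_ (∣endsOnly-path∣ left) (∣subset-++∣ (path right) matching (endsOnly (path right)) ⊥) ⟩
    2 + (∣ endsOnly (path right) ∣ + ∣ ⊥ {length matching} ∣)
      ≡⟨ cong₂ (λ a b → 2 + (a + b)) (∣endsOnly-path∣ right) (∣⊥∣≡0 (length matching)) ⟩
    4 ∎
    where open ≡-Reasoning

  pick-contracted : pick (edges G) contracted ≡
                    (endEdges left ++ endEdges right , innerEdges left ++ innerEdges right ++ matching)
  pick-contracted = begin
    pick (edges G) contracted
      ≡⟨ pick-subset-++ (path left) (path right ++ matching) (endsOnly (path left)) contractedʳ ⟩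
    zip _++_ _++_ (pick (path left) (endsOnly (path left))) (pick (path right ++ matching) contractedʳ)
      ≡⟨ cong₂ (zip _++_ _++_) (pick-path left) (pick-subset-++ (path right) matching (endsOnly (path right)) ⊥) ⟩
    zip _++_ _++_ (endEdges left , innerEdges left)
                  (zip _++_ _++_ (pick (path right) (endsOnly (path right))) (pick matching ⊥))
      ≡⟨ cong₂ (λ p q → zip _++_ _++_ (endEdges left , innerEdges left) (zip _++_ _++_ p q))
               (pick-path right) (pick-⊥ matching) ⟩
    (endEdges left ++ endEdges right ++ [] , innerEdges left ++ innerEdges right ++ matching)
      ≡⟨ cong (λ es → endEdges left ++ es , innerEdges left ++ innerEdges right ++ matching)
              (++-identityʳ (endEdges right)) ⟩
    (endEdges left ++ endEdges right , innerEdges left ++ innerEdges right ++ matching)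
      ∎
    where open ≡-Reasoning

  vertexBlock-identifies : Identifies vertexBlock (selected G contracted)
  vertexBlock-identifies = subst (Identifies vertexBlock) (sym (cong proj₁ pick-contracted))
    (List.++⁺ (endEdges-identified left vertexBlock (toBlock ∘ (_↑ˡ M)) (vertexBlock-join ∘ inj₁))
              (endEdges-identified right vertexBlock (toBlock ∘ (M ↑ʳ_)) vertexBlock-right))

  quotient-representative : ∀ x → quotient G contracted (representative (vertexBlock x)) ≡ quotient G contracted x
  quotient-representative x =
    subst (λ y → q (representative (vertexBlock y)) ≡ q y) (join-splitAt n n x) (on-join (splitAt n x))
    where
    q = quotient G contracted
    ends : Identifies q (endEdges left) × Identifies q (endEdges right)
    ends = List.++⁻ (endEdges left) (subst (Identifies q) (cong proj₁ pick-contracted)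
                                       (All.fromList⁻ (quot-identifies (N G) (fromList (selected G contracted)))))
    on-join : ∀ z → q (representative (vertexBlock (join n n z))) ≡ q (join n n z)
    on-join z = trans (cong q (representative-vertexBlock z)) (lift z)
      where
      lift : ∀ z → q (join n n (liftBlockˢ (blockOfˢ z))) ≡ q (join n n z)
      lift (inj₁ i) = liftBlock-blockOf left q (proj₁ ends) i
      lift (inj₂ k) =
        trans (liftBlock-blockOf right q (proj₂ ends) (σ ⟨$⟩ˡ k)) (cong (q ∘ (n ↑ʳ_)) (inverseʳ σ))

  -- The default (zero , zero) is never used: every variable of φ lies in exactly two blocks.
  tseitinEdge : Var → Fin (length φ) × Fin (length φ)
  tseitinEdge v = fromMaybe (zero , zero) (exactlyTwo (blocksContaining φ v))

  record EdgeOf (v : Var) (e : Fin (n + n) × Fin (n + n)) : Set where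
    constructor edgeOf
    field blocks≡ : blocks v ≡ toℕ (vertexBlock (proj₁ e)) ∷ toℕ (vertexBlock (proj₂ e)) ∷ []

  exactlyTwo-EdgeOf : ∀ {v e} → EdgeOf v e → exactlyTwo (blocksContaining φ v) ≡ just (mapPair vertexBlock e)
  exactlyTwo-EdgeOf {v} (edgeOf blocks≡) =
    cong exactlyTwo (map-injective toℕ-injective (trans (toℕ-blocksContaining φ v) blocks≡))

  tseitinEdge-EdgeOf : ∀ {v e} → EdgeOf v e → tseitinEdge v ≡ mapPair vertexBlock e
  tseitinEdge-EdgeOf edge = cong (fromMaybe (zero , zero)) (exactlyTwo-EdgeOf edge)

  EdgeOf⇒∈varsOf : ∀ {v e} → EdgeOf v e → v ∈ varsOf φ
  EdgeOf⇒∈varsOf {v} (edgeOf blocks≡) = Equivalence.from (∈-varsOf⇔ φ)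
    (indicesᵇ≢[]⇒Any (occursIn v) φ λ blocks≡[] → contradiction (trans (sym blocks≡) blocks≡[]) λ ())

  s-edge : ∀ d → EdgeOf (sv (toℕ d)) (innerEdge left d)
  s-edge d = edgeOf $ trans (blocks-s (toℕ d) (s≤s⁻¹ (toℕ<n d)))
    (sym (cong₂ (λ a b → a ∷ b ∷ []) (trans (toℕ-vertexBlock-left (inject₁ d)) (toℕ-inject₁ d))
                                     (toℕ-vertexBlock-left (suc d))))

  t-edge : ∀ d → EdgeOf (tv (toℕ d)) (innerEdge right d)
  t-edge d = edgeOf $ trans (blocks-t (toℕ d) (s≤s⁻¹ (toℕ<n d)))
    (sym (cong₂ (λ a b → a ∷ b ∷ [])
                (trans (toℕ-vertexBlock-right (inject₁ d)) (cong (M +_) (toℕ-inject₁ d)))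
                (toℕ-vertexBlock-right (suc d))))

  x-edge : ∀ i → EdgeOf (xv (toℕ i)) (i ↑ˡ n , n ↑ʳ i)
  x-edge i = edgeOf $ trans (blocks-x i)
    (sym (cong₂ (λ a b → a ∷ b ∷ []) (toℕ-vertexBlock-↑ˡ i) (toℕ-vertexBlock-↑ʳ i)))

  sVars tVars xVars labels : List Var
  sVars  = tabulate {n = suc m} (sv ∘ toℕ)
  tVars  = tabulate {n = suc m} (tv ∘ toℕ)
  xVars  = map (xv ∘ toℕ) (allFin n)
  labels = sVars ++ tVars ++ xVars

  labelled : Pointwise EdgeOf labels (unselected G contracted)
  labelled = subst (Pointwise EdgeOf labels) (sym (cong proj₂ pick-contracted))
    (Pointwise.++⁺ (Pointwise.tabulate⁺ {f = sv ∘ toℕ} {g = innerEdge left} s-edge)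
      (Pointwise.++⁺ (Pointwise.tabulate⁺ {f = tv ∘ toℕ} {g = innerEdge right} t-edge)
                     (Pointwise.map⁺ (xv ∘ toℕ) (λ i → i ↑ˡ n , n ↑ʳ i)
                                     (Pointwise.refl (λ {i} → x-edge i)))))

  labels-unique : Unique labels
  labels-unique = Unique.++⁺ (Unique.tabulate⁺ {f = sv ∘ toℕ} (toℕ-injective ∘ sv-injective))
    (Unique.++⁺ (Unique.tabulate⁺ {f = tv ∘ toℕ} (toℕ-injective ∘ tv-injective))
                (Unique.map⁺ (toℕ-injective ∘ xv-injective) (Unique.allFin⁺ n)) t∉x)
    s∉t++x
    where
    t∉x : ∀ {v} → ¬ (v ∈ tVars × v ∈ xVars)
    t∉x (v∈t , v∈x) with ∈-tabulate⁻ {f = tv ∘ toℕ} v∈t | ∈-map⁻ (xv ∘ toℕ) v∈x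
    ... | _ , refl | _ , _ , ()
    s∉t++x : ∀ {v} → ¬ (v ∈ sVars × v ∈ tVars ++ xVars)
    s∉t++x (v∈s , v∈t++x) with ∈-tabulate⁻ {f = sv ∘ toℕ} v∈s | ∈-++⁻ tVars v∈t++x
    ... | _ , refl | inj₁ v∈t with () ← proj₂ (∈-tabulate⁻ {f = tv ∘ toℕ} v∈t)
    ... | _ , refl | inj₂ v∈x with () ← proj₂ (proj₂ (∈-map⁻ (xv ∘ toℕ) v∈x))

  xv∈xVars : ∀ {a} → a < n → xv a ∈ xVars
  xv∈xVars a<n = subst (_∈ xVars) (cong xv (toℕ-fromℕ< a<n)) (∈-map⁺ (xv ∘ toℕ) (∈-allFin (fromℕ< a<n)))

  sv∈sVars : ∀ {d} → d ≤ m → sv d ∈ sVars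
  sv∈sVars d≤m =
    subst (_∈ sVars) (cong sv (toℕ-fromℕ< (s≤s d≤m))) (∈-tabulate⁺ {f = sv ∘ toℕ} (fromℕ< (s≤s d≤m)))

  tv∈tVars : ∀ {d} → d ≤ m → tv d ∈ tVars
  tv∈tVars d≤m =
    subst (_∈ tVars) (cong tv (toℕ-fromℕ< (s≤s d≤m))) (∈-tabulate⁺ {f = tv ∘ toℕ} (fromℕ< (s≤s d≤m)))

  vars⊆labels : ∀ {v} → v ∈ varsOf φ → v ∈ labels
  vars⊆labels {v} v∈ = occurring v (Any⇒indicesᵇ≢[] (occursIn v) (Equivalence.to (∈-varsOf⇔ φ) v∈))
    where
    occurring : ∀ v → blocks v ≢ [] → v ∈ labels
    occurring (xv a) occurs with a ℕ.<? n
    ... | yes a<n = ∈-++⁺ʳ sVars (∈-++⁺ʳ tVars (xv∈xVars a<n))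
    ... | no a≮n  = contradiction (blocks-x-absent a (ℕ.≮⇒≥ a≮n)) occurs
    occurring (sv d) occurs with d ℕ.≤? m
    ... | yes d≤m = ∈-++⁺ˡ (sv∈sVars d≤m)
    ... | no d≰m  = contradiction (blocks-s-absent d (ℕ.≰⇒> d≰m)) occurs
    occurring (tv d) occurs with d ℕ.≤? m
    ... | yes d≤m = ∈-++⁺ʳ sVars (∈-++⁺ˡ (tv∈tVars d≤m))
    ... | no d≰m  = contradiction (blocks-t-absent d (ℕ.≰⇒> d≰m)) occurs

  vars↔labels : Reindexing id (varsOf φ) labels
  vars↔labels = Reindexing-unique (varsOf-unique φ) labels-unique vars⊆labels
                  (λ v∈ → EdgeOf⇒∈varsOf (proj₂ (Pointwise-∈ labelled v∈)))

  Tseitin : Graph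
  Tseitin = graph (length φ) (map tseitinEdge (varsOf φ))

  tseitinGraph-φ : tseitinGraph φ ≡ just Tseitin
  tseitinGraph-φ = tseitinGraph-just φ tseitinEdge λ v∈ → exact (proj₂ (Pointwise-∈ labelled (vars⊆labels v∈)))
    where
    exact : ∀ {v e} → EdgeOf v e → exactlyTwo (blocksContaining φ v) ≡ just (tseitinEdge v)
    exact edge rewrite exactlyTwo-EdgeOf edge = refl

  edges-reindexing : Reindexing id (edges Tseitin) (map (mapPair vertexBlock) (unselected G contracted))
  edges-reindexing = subst (Reindexing id (edges Tseitin)) labels-images
    (Reindexing-mapˡ {F = id} {xs = varsOf φ} tseitinEdge
      (Reindexing-mapʳ {F = id} {xs = varsOf φ} {ys = labels} tseitinEdge vars↔labels))
    where
    labels-images : map tseitinEdge labels ≡ map (mapPair vertexBlock) (unselected G contracted)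
    labels-images = Pointwise-≡⇒≡ (Pointwise.map⁺ tseitinEdge (mapPair vertexBlock)
                      (Pointwise.map tseitinEdge-EdgeOf labelled))

  Tseitin≅contraction : Tseitin ≅ contract G contracted
  Tseitin≅contraction = contract-≅ G contracted Tseitin vertexBlock representative
    vertexBlock-representative vertexBlock-identifies quotient-representative edges-reindexing

lemma2 : (n : ℕ) → 4 ≤ n → (σ : Permutation′ n) →
    Σ Graph λ T → tseitinGraph (rPar n σ) ≡ just T ×
      Σ (Subset (length (edges (Gσ n σ)))) λ F → ∣ F ∣ ≡ 4 × (T ≅ contract (Gσ n σ) F)
lemma2 .(4 + m) (s≤s (s≤s (s≤s (s≤s (z≤n {m}))))) σ =
  Tseitin , tseitinGraph-φ , contracted , ∣contracted∣ , Tseitin≅contraction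
  where open TseitinGraphOfRPar m σ
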